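{- PM-VC-Sym can be expressed in extended monadic second-order logic with polynomial length: for every graph $G=(V,E,d)$ with bi-colored edges and every symmetric set $\mathcal{C}$ of legal vertex colorings, there is an extended MSO sentence, of length polynomial in the size of the instance, which holds on $G$ (with its edges arbitrarily oriented and equipped with the edge-label sets $E^i_{head},E^i_{tail}$, $i=1,\dots,d$) if and only if $G$ has a legal perfect matching with respect to $\mathcal{C}$.
   Context: A graph with bi-colored edges is $G=(V,E,d)$: finite vertex set $V$ ($|V|=n$), number of colors $d$, and a finite multiset $E$ of edges without self-loops; each edge $e$ joining $u\ne v$ carries color $c_u^e\in\{1,\dots,d\}$ at $u$ and $c_v^e$ at $v$. A perfect matching is $P\subseteq E$ covering each vertex exactly once; its inherited coloring is $c^P(v)=c_v^e$ for the unique $e\in P$ at $v$. $P$ is legal w.r.t. $\mathcal{C}\subseteq\{1,\dots,d\}^V$ if $c^P\in\mathcal{C}$. $\mathcal{C}$ is symmetric if membership depends only on the counts $\texttt{count}(c,i)=|\{v:c(v)=i\}|$, $i=1,\dots,d$. Orient each edge $e$ arbitrarily as $(u,v)$; $E^i_{head}$ is the set of edges whose color at their tail-end vertex $u$ is $i$, and $E^i_{tail}$ the set whose color at $v$ is $i$. Extended MSO on graphs: the monadic second-order logic (first-order quantification over vertices and edges, second-order quantification only over sets of vertices or edges) over the vocabulary consisting of $V$, $E$, the incidence predicate $\mathbf{edg}(e,u,v)$ (true iff $e$ is an edge from $u$ to $v$), the cardinality predicates $\mathbf{Card}_{p,m}(X)\Leftrightarrow |X|\equiv p \pmod m$ for sets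 $X$ of vertices or edges, and finitely many unary predicates $P_1,\dots,P_k$ (subsets of $V$ or $E$, serving as labels). -}

module Defs where

open import Data.Nat using (ℕ; zero; suc; _+_; _*_)
open import Data.Fin using (Fin; _≟_)
open import Data.Fin.Subset as Sub using (Subset)
open import Data.List as List using (List; []; _∷_; allFin; filter)
open import Data.List.Membership.Propositional as LM using ()
open import Data.Vec using (Vec; tabulate)
open import Data.Product using (Σ; ∃; ∃-syntax; _×_; _,_)
open import Data.Sum using (_⊎_)
open import Relation.Binary.PropositionalEquality using (_≡_; _≢_)
open import Relation.Nullary using (¬_)

data Sort : Set where
  vtx edge vset eset : Sort

Ctx : Set
Ctx = List Sort

data Var : Ctx → Sort → Set where
  here  : ∀ {Γ s} → Var (s ∷ Γ) s
  there : ∀ {Γ s t} → Var Γ s → Var (t ∷ Γ) s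

data Formula (LV LE : Set) (Γ : Ctx) : Set where
  edg   : Var Γ edge → Var Γ vtx → Var Γ vtx → Formula LV LE Γ
  eqV   : Var Γ vtx → Var Γ vtx → Formula LV LE Γ
  eqE   : Var Γ edge → Var Γ edge → Formula LV LE Γ
  memV  : Var Γ vtx → Var Γ vset → Formula LV LE Γ
  memE  : Var Γ edge → Var Γ eset → Formula LV LE Γ
  cardV : (p m : ℕ) → Var Γ vset → Formula LV LE Γ
  cardE : (p m : ℕ) → Var Γ eset → Formula LV LE Γ
  labV  : LV → Var Γ vtx → Formula LV LE Γ
  labE  : LE → Var Γ edge → Formula LV LE Γ
  neg   : Formula LV LE Γ → Formula LV LE Γ
  conj  : Formula LV LE Γ → Formula LV LE Γ → Formula LV LE Γ
  disj  : Formula LV LE Γ → Formula LV LE Γ → Formula LV LE Γ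
  ex    : (s : Sort) → Formula LV LE (s ∷ Γ) → Formula LV LE Γ
  all   : (s : Sort) → Formula LV LE (s ∷ Γ) → Formula LV LE Γ

Sentence : Set → Set → Set
Sentence LV LE = Formula LV LE []

-- Length of a formula: one symbol per connective/quantifier/atom;
-- the numbers p, m of Card_{p,m} are counted in unary.
len : ∀ {LV LE Γ} → Formula LV LE Γ → ℕ
len (edg _ _ _)   = 1
len (eqV _ _)     = 1
len (eqE _ _)     = 1
len (memV _ _)    = 1
len (memE _ _)    = 1
len (cardV p m _) = 1 + p + m
len (cardE p m _) = 1 + p + m
len (labV _ _)    = 1
len (labE _ _)    = 1
len (neg φ)       = 1 + len φ
len (conj φ ψ)    = 1 + len φ + len ψ
len (disj φ ψ)    = 1 + len φ + len ψ
len (ex _ φ)      = 1 + len φ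
len (all _ φ)     = 1 + len φ

record Structure (LV LE : Set) : Set₁ where
  field
    nV   : ℕ
    nE   : ℕ
    edgR : Fin nE → Fin nV → Fin nV → Set
    labVR : LV → Fin nV → Set
    labER : LE → Fin nE → Set

module _ {LV LE : Set} (S : Structure LV LE) where
  open Structure S

  Dom : Sort → Set
  Dom vtx  = Fin nV
  Dom edge = Fin nE
  Dom vset = Subset nV
  Dom eset = Subset nE

  data Env : Ctx → Set where
    []  : Env []
    _∷_ : ∀ {s Γ} → Dom s → Env Γ → Env (s ∷ Γ)

  lookupEnv : ∀ {Γ s} → Env Γ → Var Γ s → Dom s
  lookupEnv (x ∷ ρ) here      = x
  lookupEnv (x ∷ ρ) (there i) = lookupEnv ρ i

  -- a ≡ p (mod m); for m = 0 this is a ≡ p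
  CongMod : ℕ → ℕ → ℕ → Set
  CongMod a p m = ∃[ k ] (a ≡ p + k * m ⊎ p ≡ a + k * m)

  Sat : ∀ {Γ} → Formula LV LE Γ → Env Γ → Set
  Sat (edg e u v)   ρ = edgR (lookupEnv ρ e) (lookupEnv ρ u) (lookupEnv ρ v)
  Sat (eqV x y)     ρ = lookupEnv ρ x ≡ lookupEnv ρ y
  Sat (eqE x y)     ρ = lookupEnv ρ x ≡ lookupEnv ρ y
  Sat (memV x X)    ρ = lookupEnv ρ x Sub.∈ lookupEnv ρ X
  Sat (memE x X)    ρ = lookupEnv ρ x Sub.∈ lookupEnv ρ X
  Sat (cardV p m X) ρ = CongMod (Sub.∣ lookupEnv ρ X ∣) p m
  Sat (cardE p m X) ρ = CongMod (Sub.∣ lookupEnv ρ X ∣) p m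
  Sat (labV l x)    ρ = labVR l (lookupEnv ρ x)
  Sat (labE l x)    ρ = labER l (lookupEnv ρ x)
  Sat (neg φ)       ρ = ¬ Sat φ ρ
  Sat (conj φ ψ)    ρ = Sat φ ρ × Sat ψ ρ
  Sat (disj φ ψ)    ρ = Sat φ ρ ⊎ Sat ψ ρ
  Sat (ex s φ)      ρ = Σ (Dom s) λ x → Sat φ (x ∷ ρ)
  Sat (all s φ)     ρ = (x : Dom s) → Sat φ (x ∷ ρ)

  _⊨_ : Sentence LV LE → Set
  _⊨_ φ = Sat φ []

-- Graphs with bi-colored edges: vertices Fin n, colours Fin d
-- (colour i+1 of the paper is Fin element i), edges Fin m, a multiset
-- of edges; each edge e is oriented from tl e to hd e.

record BiGraph (n d : ℕ) : Set where
  field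
    m      : ℕ
    tl hd  : Fin m → Fin n
    ctl    : Fin m → Fin d   -- colour of e at its tail-end tl e
    chd    : Fin m → Fin d   -- colour of e at its head-end hd e
    noLoop : ∀ e → tl e ≢ hd e

module _ {n d : ℕ} (G : BiGraph n d) where
  open BiGraph G

  Incident : Fin m → Fin n → Set
  Incident e v = tl e ≡ v ⊎ hd e ≡ v

  IsPerfectMatching : Subset m → Set
  IsPerfectMatching P =
    ∀ v → ∃[ e ] (e Sub.∈ P × Incident e v ×
                 (∀ e' → e' Sub.∈ P → Incident e' v → e' ≡ e))

  InheritedColoring : Subset m → (Fin n → Fin d) → Set
  InheritedColoring P c = ∀ e → e Sub.∈ P → c (tl e) ≡ ctl e × c (hd e) ≡ chd e

count : ∀ {n d} → (Fin n → Fin d) → Fin d → ℕ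
count {n} c i = List.length (filter (λ v → c v ≟ i) (allFin n))

countVec : ∀ {n d} → (Fin n → Fin d) → Vec ℕ d
countVec c = tabulate (count c)

-- A symmetric set 𝒞 ⊆ {colours}^V is given by the (finite) list L of
-- admissible count vectors: c ∈ 𝒞 iff (count(c,i))_i ∈ L.
InC : ∀ {n d} → List (Vec ℕ d) → (Fin n → Fin d) → Set
InC L c = countVec c LM.∈ L

HasLegalPM : ∀ {n d} → BiGraph n d → List (Vec ℕ d) → Set
HasLegalPM {n} {d} G L =
  ∃[ P ] (IsPerfectMatching G P ×
          ∃[ c ] (InheritedColoring G P c × InC L c))

-- G as a structure: vocabulary V, E, edg, and edge labels
-- E^i_head (colour at tail-end is i), E^i_tail (colour at head-end is i).

data EdgeLabel (d : ℕ) : Set where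
  Ehead Etail : Fin d → EdgeLabel d

data NoLabel : Set where

toStructure : ∀ {n d} → BiGraph n d → Structure NoLabel (EdgeLabel d)
toStructure {n} {d} G = record
  { nV = n
  ; nE = m
  ; edgR = λ e u v → tl e ≡ u × hd e ≡ v
  ; labVR = λ ()
  ; labER = lab
  }
  where
    open BiGraph G
    lab : EdgeLabel d → Fin m → Set
    lab (Ehead i) e = ctl e ≡ i
    lab (Etail i) e = chd e ≡ i

-- size of the part of the instance the sentence may depend on
instSize : ∀ {d} → ℕ → List (Vec ℕ d) → ℕ
instSize {d} n L = n + d + List.length L

-- The sentence guesses a set P of edges, says that P is a perfect matching,
-- and then lists the admissible count vectors a ∈ L: for each colour i it
-- guesses the set of vertices whose P-edge carries colour i at that vertex
-- and requires this set to have exactly a_i elements (Card_{a_i,0}).  Both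
-- "the P-edge at v has colour i at v" and "P is a perfect matching" use only
-- edg and the labels E^i_head, E^i_tail, so the sentence has O(|L| · d · n)
-- symbols, which is cubic in the size of the instance.

module Submission where

open import Defs
open import Data.Nat using (ℕ; zero; suc; _+_; _*_; _^_; _≤_; _≤?_; s≤s)
open import Data.Nat.Properties
  using ( module ≤-Reasoning; ≤-refl; ≤-trans; ≤-reflexive; m≤m+n; m≤n+m; n≤1+n
        ; +-identityʳ; *-zeroʳ; +-monoʳ-≤; +-mono-≤; *-mono-≤)
open import Data.Nat.Tactic.RingSolver using (solve-∀)
open import Data.Fin using (Fin; zero; suc; _≟_)
open import Data.Fin.Subset using (Subset; inside; outside; _∈_; ∣_∣)
open import Data.Fin.Subset.Properties using (∣p∣≤n; drop-there)
open import Data.Vec using (Vec; []; _∷_; here; there; lookup; tabulate)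
open import Data.Vec.Properties using (tabulate-cong; tabulate∘lookup; lookup∘tabulate)
open import Data.List as List using (List; []; _∷_; filter)
open import Data.List.Relation.Unary.Any as Any using (Any; here; there)
open import Data.Product using (∃-syntax; _×_; _,_; proj₁; proj₂)
open import Data.Sum as Sum using (inj₁; inj₂)
open import Level using (Level)
open import Function using (_∘_; id)
open import Function.Bundles using (_⇔_; mk⇔; Equivalence)
open import Function.Construct.Composition using (_⇔-∘_)
open import Function.Construct.Symmetry using (⇔-sym)
open import Relation.Unary using (Pred; Decidable)
open import Relation.Nullary using (¬_; Dec; yes; no; contradiction)
open import Relation.Nullary.Decidable as Dec using (decidable-stable)
open import Relation.Binary.PropositionalEquality using (_≡_; refl; sym; trans; cong)

open Equivalence using (to; from)

private
  variable
    ℓ : Level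
    A : Set
    k n d : ℕ

suc∈∷⇔ : ∀ {s} {X : Subset k} {v} → suc v ∈ s ∷ X ⇔ v ∈ X
suc∈∷⇔ = mk⇔ drop-there there

comprehension : {P : Pred (Fin k) ℓ} → Decidable P → ∃[ X ] (∀ v → v ∈ X ⇔ P v)
comprehension {zero}  P? = [] , λ ()
comprehension {suc k} P? with comprehension (P? ∘ suc) | P? zero
... | X , X⇔P | yes p = inside ∷ X ,
  λ { zero → mk⇔ (λ _ → p) (λ _ → here) ; (suc v) → X⇔P v ⇔-∘ suc∈∷⇔ }
... | X , X⇔P | no ¬p = outside ∷ X ,
  λ { zero → mk⇔ (λ ()) (λ p → contradiction p ¬p) ; (suc v) → X⇔P v ⇔-∘ suc∈∷⇔ }

∣∣≡length-filter : {P : Pred A ℓ} (P? : Decidable P) (h : Fin k → A) (X : Subset k) →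
                   (∀ v → v ∈ X ⇔ P (h v)) → ∣ X ∣ ≡ List.length (filter P? (List.tabulate h))
∣∣≡length-filter P? h [] X⇔P = refl
∣∣≡length-filter P? h (s ∷ X) X⇔P with s | P? (h zero)
... | inside  | yes _ =
  cong suc (∣∣≡length-filter P? (h ∘ suc) X (λ v → X⇔P (suc v) ⇔-∘ ⇔-sym suc∈∷⇔))
... | inside  | no ¬p = contradiction (to (X⇔P zero) here) ¬p
... | outside | yes p = contradiction (from (X⇔P zero) p) λ ()
... | outside | no _  =
  ∣∣≡length-filter P? (h ∘ suc) X (λ v → X⇔P (suc v) ⇔-∘ ⇔-sym suc∈∷⇔)

∣∣≡count : {c : Fin n → Fin d} {i : Fin d} (X : Subset n) → (∀ v → v ∈ X ⇔ c v ≡ i) → ∣ X ∣ ≡ count c i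
∣∣≡count {c = c} {i} X = ∣∣≡length-filter (λ v → c v ≟ i) id X

tabulate≡⇔ : {f : Fin k → A} {xs : Vec A k} → tabulate f ≡ xs ⇔ (∀ i → f i ≡ lookup xs i)
tabulate≡⇔ {f = f} {xs} = mk⇔
  (λ f≡xs i → trans (sym (lookup∘tabulate f i)) (cong (λ ys → lookup ys i) f≡xs))
  (λ f≗xs → trans (tabulate-cong f≗xs) (tabulate∘lookup xs))

module _ {LV LE : Set} {Γ : Ctx} where

  ⊤ᶠ ⊥ᶠ : Formula LV LE Γ
  ⊤ᶠ = all vtx (eqV here here)
  ⊥ᶠ = neg ⊤ᶠ

  _⇒ᶠ_ _⇔ᶠ_ : Formula LV LE Γ → Formula LV LE Γ → Formula LV LE Γ
  φ ⇒ᶠ ψ = neg (conj φ (neg ψ))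
  φ ⇔ᶠ ψ = disj (conj φ ψ) (conj (neg φ) (neg ψ))

  ⋀ᶠ : (Fin k → Formula LV LE Γ) → Formula LV LE Γ
  ⋀ᶠ {zero}  f = ⊤ᶠ
  ⋀ᶠ {suc k} f = conj (f zero) (⋀ᶠ (f ∘ suc))

  ⋁ᶠ : (A → Formula LV LE Γ) → List A → Formula LV LE Γ
  ⋁ᶠ f []       = ⊥ᶠ
  ⋁ᶠ f (x ∷ xs) = disj (f x) (⋁ᶠ f xs)

  -- A size above the bound is written as ⊥ᶠ rather than as Card_{p,0}, so
  -- that the length of the formula does not grow with p.
  hasSize : (bound p : ℕ) → Var Γ vset → Formula LV LE Γ
  hasSize bound p X with p ≤? bound
  ... | yes _ = cardV p 0 X
  ... | no _  = ⊥ᶠ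

  len-⋀ᶠ : ∀ {M} (f : Fin k → Formula LV LE Γ) → (∀ i → len (f i) ≤ M) → len (⋀ᶠ f) ≤ suc k * (2 + M)
  len-⋀ᶠ {zero}  {M} f f≤M = m≤m+n 2 (M + 0)
  len-⋀ᶠ {suc k} {M} f f≤M =
    s≤s (+-mono-≤ (≤-trans (f≤M zero) (m≤n+m M 1)) (len-⋀ᶠ (f ∘ suc) (f≤M ∘ suc)))

  len-⋁ᶠ : ∀ {M} (f : A → Formula LV LE Γ) → (∀ x → len (f x) ≤ M) →
           ∀ xs → len (⋁ᶠ f xs) ≤ suc (List.length xs) * (3 + M)
  len-⋁ᶠ {M = M} f f≤M []       = m≤m+n 3 (M + 0)
  len-⋁ᶠ {M = M} f f≤M (x ∷ xs) = s≤s (+-mono-≤ (≤-trans (f≤M x) (m≤n+m M 2)) (len-⋁ᶠ f f≤M xs))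

  len-hasSize : ∀ bound p (X : Var Γ vset) → len (hasSize bound p X) ≤ 3 + bound
  len-hasSize bound p X with p ≤? bound
  ... | yes p≤b = s≤s (≤-trans (≤-reflexive (+-identityʳ p)) (≤-trans p≤b (m≤n+m bound 2)))
  ... | no _    = m≤m+n 3 bound

module _ {LV LE : Set} (S : Structure LV LE) {Γ : Ctx} (ρ : Env S Γ) where

  ⊥ᶠ-unsat : ¬ Sat S ⊥ᶠ ρ
  ⊥ᶠ-unsat ⊤ᶠ-unsat = ⊤ᶠ-unsat (λ _ → refl)

  ⇔ᶠ-sound : {φ ψ : Formula LV LE Γ} → Sat S (φ ⇔ᶠ ψ) ρ → Sat S φ ρ ⇔ Sat S ψ ρ
  ⇔ᶠ-sound (inj₁ (φ , ψ))   = mk⇔ (λ _ → ψ) (λ _ → φ)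
  ⇔ᶠ-sound (inj₂ (¬φ , ¬ψ)) = mk⇔ (λ φ → contradiction φ ¬φ) (λ ψ → contradiction ψ ¬ψ)

  ⇔ᶠ-complete : {φ ψ : Formula LV LE Γ} → Dec (Sat S ψ ρ) → Sat S φ ρ ⇔ Sat S ψ ρ → Sat S (φ ⇔ᶠ ψ) ρ
  ⇔ᶠ-complete (yes ψ) φ⇔ψ = inj₁ (from φ⇔ψ ψ , ψ)
  ⇔ᶠ-complete (no ¬ψ) φ⇔ψ = inj₂ (¬ψ ∘ to φ⇔ψ , ¬ψ)

  ⋀ᶠ-sat : (f : Fin k → Formula LV LE Γ) → Sat S (⋀ᶠ f) ρ ⇔ (∀ i → Sat S (f i) ρ)
  ⋀ᶠ-sat {zero}  f = mk⇔ (λ _ ()) (λ _ _ → refl)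
  ⋀ᶠ-sat {suc k} f = mk⇔
    (λ { (f₀ , f₊) zero → f₀ ; (f₀ , f₊) (suc i) → to (⋀ᶠ-sat (f ∘ suc)) f₊ i })
    (λ fᵢ → fᵢ zero , from (⋀ᶠ-sat (f ∘ suc)) (fᵢ ∘ suc))

  ⋁ᶠ-sat : (f : A → Formula LV LE Γ) (xs : List A) → Sat S (⋁ᶠ f xs) ρ ⇔ Any (λ x → Sat S (f x) ρ) xs
  ⋁ᶠ-sat f [] = mk⇔ (λ ⊥ᶠ-sat → contradiction ⊥ᶠ-sat ⊥ᶠ-unsat) (λ ())
  ⋁ᶠ-sat f (x ∷ xs) = mk⇔
    (λ { (inj₁ fx) → here fx ; (inj₂ fxs) → there (to (⋁ᶠ-sat f xs) fxs) })
    (λ { (here fx) → inj₁ fx ; (there fxs) → inj₂ (from (⋁ᶠ-sat f xs) fxs) })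

  congMod-zero : ∀ {a p} → CongMod S a p 0 ⇔ a ≡ p
  congMod-zero {a} {p} = mk⇔
    (λ { (q , inj₁ a≡p+q0) → trans a≡p+q0 (trans (cong (p +_) (*-zeroʳ q)) (+-identityʳ p))
       ; (q , inj₂ p≡a+q0) → sym (trans p≡a+q0 (trans (cong (a +_) (*-zeroʳ q)) (+-identityʳ a))) })
    (λ a≡p → 0 , inj₁ (trans a≡p (sym (+-identityʳ p))))

  hasSize-sat : ∀ {bound p} (X : Var Γ vset) → Structure.nV S ≤ bound →
                Sat S (hasSize bound p X) ρ ⇔ ∣ lookupEnv S ρ X ∣ ≡ p
  hasSize-sat {bound} {p} X nV≤b with p ≤? bound
  ... | yes _ = congMod-zero
  ... | no p≰b = mk⇔ (λ ⊥ᶠ-sat → contradiction ⊥ᶠ-sat ⊥ᶠ-unsat)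
                     (λ { refl → contradiction (≤-trans (∣p∣≤n (lookupEnv S ρ X)) nV≤b) p≰b })

cubic-bound : ∀ a b c s → a + suc s * (b + suc s * (c + suc s)) ≤ (a + b + c + 1) * suc s ^ 3
cubic-bound a b c s = ≤-trans (m≤m+n _ _) (≤-reflexive (expansion a b c s))
  where
  expansion : ∀ a b c s →
    a + (1 + s) * (b + (1 + s) * (c + (1 + s)))
      + (a * (3 * s + 3 * (s * s) + s * s * s) + b * ((1 + s) * (2 * s + s * s)) + c * ((1 + s) * (1 + s) * s))
    ≡ (a + b + c + 1) * ((1 + s) * ((1 + s) * ((1 + s) * 1)))
  expansion = solve-∀

module GraphFormulas (n d : ℕ) where

  Fm : Ctx → Set
  Fm = Formula NoLabel (EdgeLabel d)

  private
    variable
      Γ : Ctx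

  tailIs headIs incident : Var Γ edge → Var Γ vtx → Fm Γ
  tailIs e v   = ex vtx (edg (there e) (there v) here)
  headIs e v   = ex vtx (edg (there e) here (there v))
  incident e v = disj (tailIs e v) (headIs e v)

  perfectMatching : Var Γ eset → Fm Γ
  perfectMatching P =
    all vtx (ex edge (conj (memE here (there (there P)))
                     (conj (incident here (there here))
                           (all edge (conj (memE here (there (there (there P))))
                                           (incident here (there (there here)))
                                      ⇒ᶠ eqE here (there here))))))

  hasColour : Fin d → Var Γ vtx → Var Γ eset → Fm Γ
  hasColour i v P =
    ex edge (conj (memE here (there P))
                  (disj (conj (tailIs here (there v)) (labE (Ehead i) here))
                        (conj (headIs here (there v)) (labE (Etail i) here))))

  colourCountIs : Fin d → ℕ → Var Γ eset → Fm Γ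
  colourCountIs i p P =
    ex vset (conj (all vtx (memV here (there here) ⇔ᶠ hasColour i here (there (there P))))
                  (hasSize n p here))

  colourCountsAre : Vec ℕ d → Var Γ eset → Fm Γ
  colourCountsAre a P = ⋀ᶠ (λ i → colourCountIs i (lookup a i) P)

  legalPerfectMatching : List (Vec ℕ d) → Fm []
  legalPerfectMatching L = ex eset (conj (perfectMatching here) (⋁ᶠ (λ a → colourCountsAre a here) L))

  len-legalPerfectMatching : ∀ L → len (legalPerfectMatching L) ≤ 67 * suc (instSize n L) ^ 3
  len-legalPerfectMatching L = begin
    len (legalPerfectMatching L)              ≤⟨ +-monoʳ-≤ 24 (len-⋁ᶠ _ len-counts L) ⟩
    24 + suc l * (3 + suc d * (39 + n))       ≤⟨ +-monoʳ-≤ 24 (*-mono-≤ l<t (+-monoʳ-≤ 3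
                                                   (*-mono-≤ d<t (+-monoʳ-≤ 39 n≤t)))) ⟩
    24 + suc s * (3 + suc s * (39 + suc s))   ≤⟨ cubic-bound 24 3 39 s ⟩
    67 * suc s ^ 3                            ∎
    where
    open ≤-Reasoning
    l = List.length L
    s = instSize n L
    len-counts : ∀ a → len (colourCountsAre {eset ∷ []} a here) ≤ suc d * (39 + n)
    len-counts a = len-⋀ᶠ _ (λ i → +-monoʳ-≤ 34 (len-hasSize n (lookup a i) here))
    n≤t : n ≤ suc s
    n≤t = ≤-trans (≤-trans (m≤m+n n d) (m≤m+n (n + d) l)) (n≤1+n s)
    d<t : suc d ≤ suc s
    d<t = s≤s (≤-trans (m≤n+m d n) (m≤m+n (n + d) l))
    l<t : suc l ≤ suc s
    l<t = s≤s (m≤n+m l (n + d))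

module GraphSemantics {n d : ℕ} (G : BiGraph n d) where
  open BiGraph G
  open GraphFormulas n d

  S : Structure NoLabel (EdgeLabel d)
  S = toStructure G

  colourAt : Fin m → Fin n → Fin d
  colourAt e v with tl e ≟ v
  ... | yes _ = ctl e
  ... | no _  = chd e

  colourAt-tl : ∀ e → colourAt e (tl e) ≡ ctl e
  colourAt-tl e with tl e ≟ tl e
  ... | yes _  = refl
  ... | no tl≢tl = contradiction refl tl≢tl

  colourAt-hd : ∀ e → colourAt e (hd e) ≡ chd e
  colourAt-hd e with tl e ≟ hd e
  ... | yes tl≡hd = contradiction tl≡hd (noLoop e)
  ... | no _      = refl

  inheritedColouring : ∀ {P} → IsPerfectMatching G P → ∃[ c ] InheritedColoring G P c
  inheritedColouring {P} pm = c , λ e e∈P →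
    trans (c-at e∈P (inj₁ refl)) (colourAt-tl e) , trans (c-at e∈P (inj₂ refl)) (colourAt-hd e)
    where
    c : Fin n → Fin d
    c v = colourAt (proj₁ (pm v)) v
    c-at : ∀ {e v} → e ∈ P → Incident G e v → c v ≡ colourAt e v
    c-at {e} {v} e∈P e∼v with pm v
    ... | _ , _ , _ , unique = cong (λ e′ → colourAt e′ v) (sym (unique e e∈P e∼v))

  module _ {Γ : Ctx} (ρ : Env S Γ) where

    tailIs-sat : ∀ e v → Sat S (tailIs e v) ρ ⇔ tl (lookupEnv S ρ e) ≡ lookupEnv S ρ v
    tailIs-sat e v = mk⇔ (λ (_ , tl≡v , _) → tl≡v) (λ tl≡v → hd (lookupEnv S ρ e) , tl≡v , refl)

    headIs-sat : ∀ e v → Sat S (headIs e v) ρ ⇔ hd (lookupEnv S ρ e) ≡ lookupEnv S ρ v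
    headIs-sat e v = mk⇔ (λ (_ , _ , hd≡v) → hd≡v) (λ hd≡v → tl (lookupEnv S ρ e) , refl , hd≡v)

    incident-sat : ∀ e v → Sat S (incident e v) ρ ⇔ Incident G (lookupEnv S ρ e) (lookupEnv S ρ v)
    incident-sat e v = mk⇔ (Sum.map (to (tailIs-sat e v)) (to (headIs-sat e v)))
                           (Sum.map (from (tailIs-sat e v)) (from (headIs-sat e v)))

  perfectMatching-sat : ∀ {Γ} (ρ : Env S Γ) P →
                        Sat S (perfectMatching P) ρ ⇔ IsPerfectMatching G (lookupEnv S ρ P)
  perfectMatching-sat {Γ} ρ P = mk⇔ sound complete
    where
    edgeAt-sat : ∀ e v → Sat S (incident here (there here)) (e ∷ v ∷ ρ) ⇔ Incident G e v
    edgeAt-sat e v = incident-sat {edge ∷ vtx ∷ Γ} (e ∷ v ∷ ρ) here (there here)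
    rivalAt-sat : ∀ e′ e v →
                  Sat S {edge ∷ edge ∷ vtx ∷ Γ} (incident here (there (there here))) (e′ ∷ e ∷ v ∷ ρ) ⇔
                  Incident G e′ v
    rivalAt-sat e′ e v = incident-sat {edge ∷ edge ∷ vtx ∷ Γ} (e′ ∷ e ∷ v ∷ ρ) here (there (there here))
    sound : Sat S (perfectMatching P) ρ → IsPerfectMatching G (lookupEnv S ρ P)
    sound pm v with pm v
    ... | e , e∈P , e∼v , onlyE = e , e∈P , to (edgeAt-sat e v) e∼v ,
      λ e′ e′∈P e′∼v → decidable-stable (e′ ≟ e) λ e′≢e →
        onlyE e′ ((e′∈P , from (rivalAt-sat e′ e v) e′∼v) , e′≢e)
    complete : IsPerfectMatching G (lookupEnv S ρ P) → Sat S (perfectMatching P) ρ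
    complete pm v with pm v
    ... | e , e∈P , e∼v , unique = e , e∈P , from (edgeAt-sat e v) e∼v ,
      λ { e′ ((e′∈P , e′∼v) , e′≢e) → e′≢e (unique e′ e′∈P (to (rivalAt-sat e′ e v) e′∼v)) }

  atP : Subset m → Env S (eset ∷ [])
  atP P = P ∷ []

  module _ {P : Subset m} {c : Fin n → Fin d}
           (pm : IsPerfectMatching G P) (inh : InheritedColoring G P c) where

    hasColour-sat : ∀ {Γ} (ρ : Env S Γ) i v X → lookupEnv S ρ X ≡ P →
                    Sat S (hasColour i v X) ρ ⇔ c (lookupEnv S ρ v) ≡ i
    hasColour-sat ρ i v X refl = mk⇔ sound complete
      where
      sound : Sat S (hasColour i v X) ρ → c (lookupEnv S ρ v) ≡ i
      sound (e , e∈P , inj₁ ((_ , tl≡v , _) , ctl≡i)) = trans (cong c (sym tl≡v)) (trans (proj₁ (inh e e∈P)) ctl≡i)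
      sound (e , e∈P , inj₂ ((_ , _ , hd≡v) , chd≡i)) = trans (cong c (sym hd≡v)) (trans (proj₂ (inh e e∈P)) chd≡i)
      complete : c (lookupEnv S ρ v) ≡ i → Sat S (hasColour i v X) ρ
      complete cv≡i with pm (lookupEnv S ρ v)
      ... | e , e∈P , inj₁ tl≡v , _ =
        e , e∈P , inj₁ ((hd e , tl≡v , refl) , trans (sym (proj₁ (inh e e∈P))) (trans (cong c tl≡v) cv≡i))
      ... | e , e∈P , inj₂ hd≡v , _ =
        e , e∈P , inj₂ ((tl e , refl , hd≡v) , trans (sym (proj₂ (inh e e∈P))) (trans (cong c hd≡v) cv≡i))

    colourCountIs-sat : ∀ {Γ} (ρ : Env S Γ) i p X → lookupEnv S ρ X ≡ P →
                        Sat S (colourCountIs i p X) ρ ⇔ count c i ≡ p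
    colourCountIs-sat {Γ} ρ i p X ⟦X⟧≡P = mk⇔ sound complete
      where
      inY : Fm (vtx ∷ vset ∷ Γ)
      inY = memV here (there here)
      coloured : Fm (vtx ∷ vset ∷ Γ)
      coloured = hasColour i here (there (there X))
      at : Subset n → Fin n → Env S (vtx ∷ vset ∷ Γ)
      at Y v = v ∷ Y ∷ ρ
      coloured-sat : ∀ Y v → Sat S coloured (at Y v) ⇔ c v ≡ i
      coloured-sat Y v = hasColour-sat (at Y v) i here (there (there X)) ⟦X⟧≡P
      sizeOf-sat : ∀ {q} Y → Sat S (hasSize n q here) (Y ∷ ρ) ⇔ ∣ Y ∣ ≡ q
      sizeOf-sat Y = hasSize-sat S {vset ∷ Γ} (Y ∷ ρ) here ≤-refl
      sound : Sat S (colourCountIs i p X) ρ → count c i ≡ p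
      sound (Y , Y-class , ∣Y∣≡p) = trans (sym (∣∣≡count Y Y⇔)) (to (sizeOf-sat Y) ∣Y∣≡p)
        where
        Y⇔ : ∀ v → v ∈ Y ⇔ c v ≡ i
        Y⇔ v = coloured-sat Y v ⇔-∘ ⇔ᶠ-sound S (at Y v) {inY} {coloured} (Y-class v)
      complete : count c i ≡ p → Sat S (colourCountIs i p X) ρ
      complete count≡p with comprehension (λ v → c v ≟ i)
      ... | Y , Y⇔ = Y , Y-class , from (sizeOf-sat Y) (trans (∣∣≡count Y Y⇔) count≡p)
        where
        Y-class : ∀ v → Sat S (inY ⇔ᶠ coloured) (at Y v)
        Y-class v = ⇔ᶠ-complete S (at Y v) {inY} {coloured}
          (Dec.map (⇔-sym (coloured-sat Y v)) (c v ≟ i)) (⇔-sym (coloured-sat Y v) ⇔-∘ Y⇔ v)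

    colourCountsAre-sat : ∀ a → Sat S (colourCountsAre a here) (atP P) ⇔ countVec c ≡ a
    colourCountsAre-sat a = mk⇔
      (λ counts → from tabulate≡⇔ λ i → to (count-sat i) (to (⋀ᶠ-sat S (atP P) _) counts i))
      (λ c≡a → from (⋀ᶠ-sat S (atP P) _) λ i → from (count-sat i) (to tabulate≡⇔ c≡a i))
      where
      count-sat : ∀ i → Sat S (colourCountIs i (lookup a i) here) (atP P) ⇔ count c i ≡ lookup a i
      count-sat i = colourCountIs-sat (atP P) i (lookup a i) here refl

  legalPerfectMatching-sat : ∀ L → S ⊨ legalPerfectMatching L ⇔ HasLegalPM G L
  legalPerfectMatching-sat L = mk⇔ sound complete
    where
    sound : S ⊨ legalPerfectMatching L → HasLegalPM G L
    sound (P , pm-sat , legal-sat) with to (perfectMatching-sat (atP P) here) pm-sat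
    ... | pm with inheritedColouring pm
    ... | c , inh = P , pm , c , inh ,
      Any.map (to (colourCountsAre-sat pm inh _)) (to (⋁ᶠ-sat S (atP P) _ L) legal-sat)
    complete : HasLegalPM G L → S ⊨ legalPerfectMatching L
    complete (P , pm , c , inh , c∈L) = P , from (perfectMatching-sat (atP P) here) pm ,
      from (⋁ᶠ-sat S (atP P) _ L) (Any.map (from (colourCountsAre-sat pm inh _)) c∈L)

proposition25 :
  ∃[ c ] ∃[ k ] ∀ (n d : ℕ) (L : List (Vec ℕ d)) →
    ∃[ φ ] (len {NoLabel} {EdgeLabel d} φ ≤ c * suc (instSize n L) ^ k ×
            (∀ (G : BiGraph n d) → (toStructure G ⊨ φ) ⇔ HasLegalPM G L))
proposition25 = 67 , 3 , λ n d L →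
  GraphFormulas.legalPerfectMatching n d L ,
  GraphFormulas.len-legalPerfectMatching n d L ,
  λ G → GraphSemantics.legalPerfectMatching-sat G L
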